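{- Let $k$ be a nonnegative integer. Suppose $N\subset-\mathbb{N}$ and $N\in\mathsf{APS}^B_{2k+1}$. Let $P$ be the set of the $k-|N|$ smallest elements of $[2k+1]\setminus -N$. Then $N\sqcup P\in\mathsf{APS}^B_{2k+1}$.
   Context: $\mathbb{N}=\{1,2,\dots\}$, $[n]=\{1,\dots,n\}$, $-X=\{ -x:x\in X\}$, $\pm[n]=[n]\cup-[n]$. $\mathfrak{S}_n^B$ is the group of bijections $w:\pm[n]\to\pm[n]$ with $w(-i)=-w(i)$, written in one-line notation $w(1)\cdots w(n)$. A pinnacle of $w$ is a value $w(i)$ with $2\le i\le n-1$ and $w(i-1)<w(i)>w(i+1)$; the pinnacle set of $w$ is the set of its pinnacles. $\mathsf{APS}^B_n$ is the set of pinnacle sets of elements of $\mathfrak{S}_n^B$. -}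

module Defs where

open import Data.Nat using (ℕ; suc; _+_; _*_; _∸_)
open import Data.Integer using (ℤ; +_; -_; ∣_∣; _<_; _≟_)
open import Data.List using (List; []; _∷_; map; upTo; filter; take; length)
open import Data.List.Membership.Propositional using (_∈_)
open import Data.List.Membership.DecPropositional _≟_ using (_∈?_)
open import Data.List.Relation.Binary.Permutation.Propositional using (_↭_)
open import Data.Product using (Σ; _×_)
open import Function.Bundles using (_⇔_)
open import Relation.Nullary.Decidable using (¬?)

range : ℕ → List ℕ
range n = map suc (upTo n)

-- A signed permutation of [n], in one-line notation w(1)⋯w(n):
-- the absolute values of the entries are a permutation of [n].
-- (This determines a unique element of 𝔖ᴮₙ via w(-i) = -w(i).)
IsSignedPerm : ℕ → List ℤ → Set
IsSignedPerm n w = map ∣_∣ w ↭ range n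

data IsPinnacle : List ℤ → ℤ → Set where
  here  : ∀ {a b c l} → a < b → c < b → IsPinnacle (a ∷ b ∷ c ∷ l) b
  there : ∀ {a l x} → IsPinnacle l x → IsPinnacle (a ∷ l) x

IsPinnacleSetOf : List ℤ → List ℤ → Set
IsPinnacleSetOf w S = ∀ x → (x ∈ S) ⇔ IsPinnacle w x

InAPSB : ℕ → List ℤ → Set
InAPSB n S = Σ (List ℤ) λ w → IsSignedPerm n w × IsPinnacleSetOf w S

complementNeg : ℕ → List ℤ → List ℤ
complementNeg m N = filter (λ x → ¬? (x ∈? map -_ N)) (map +_ (range m))

smallestP : ℕ → List ℤ → List ℤ
smallestP k N = take (k ∸ length N) (complementNeg (2 * k + 1) N)

{-# OPTIONS --safe #-}
module Submission where

open import Defs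
open import Data.Nat using (ℕ; suc; _+_; _*_; _∸_; z≤n; s≤s; s<s; s≤s⁻¹; s<s⁻¹) renaming (_≤_ to _≤ℕ_; _<_ to _<ℕ_)
import Data.Nat.Properties as ℕ
open import Data.Nat.Tactic.RingSolver using (solve-∀)
open import Data.Integer using (ℤ; _<_; _≤_; 0ℤ; _<?_; _≤?_; _≟_; ∣_∣; +_; -_; -[1+_]; +<+)
open import Data.Integer.Properties using (≤-decTotalOrder; ∣-i∣≡∣i∣; neg-injective; neg-involutive; neg-mono-<; +-injective; <⇒≤; <-asym; <-trans; ≤-<-trans; <-≤-trans; ≤-refl; ≤-trans)
open import Data.List using (List; []; _∷_; _++_; _∷ʳ_; filter; length; map; upTo; take; drop)
open import Data.List.Properties using (++-assoc; filter-accept; filter-reject; filter-none; filter-notAll; filter-all; length-filter; filter-++; length-++; length-map; length-upTo; length-take; length-drop; take++drop≡id; map-∘; map-cong; map-id; map-++)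
open import Data.List.Sort ≤-decTotalOrder using (sort; sort-↭; sort-↗)
open import Data.List.Membership.Propositional using (_∈_; _∉_; find)
open import Data.List.Membership.DecPropositional _≟_ using (_∈?_)
open import Data.List.Membership.Propositional.Properties using (∈-++⁺ʳ; ∈-++⁺ˡ; ∈-++⁻; ∈-filter⁺; ∈-filter⁻; ∈-map⁺; ∈-map⁻; ∈-length)
open import Data.List.Membership.Propositional.Properties.WithK using (unique∧set⇒bag)
open import Data.List.Relation.Unary.Any as Any using (Any; here; there; any?)
open import Data.List.Relation.Unary.All as All using (All; []; _∷_)
import Data.List.Relation.Unary.All.Properties as AllP
open import Data.List.Relation.Unary.AllPairs using (AllPairs; []; _∷_)
import Data.List.Relation.Unary.AllPairs.Properties as APP
open import Data.List.Relation.Unary.Linked.Properties using (Linked⇒AllPairs)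
open import Data.List.Relation.Unary.Unique.Propositional using (Unique)
open import Data.List.Relation.Unary.Unique.Propositional.Properties as UP using (Unique[x∷xs]⇒x∉xs)
open import Data.List.Relation.Binary.BagAndSetEquality using (∼bag⇒↭)
open import Data.List.Relation.Binary.Permutation.Propositional using (_↭_; ↭-refl; ↭-sym; ↭-trans; prep; ↭⇒↭ₛ; module PermutationReasoning)
open import Data.List.Relation.Binary.Permutation.Propositional.Properties using (shift; ↭-length; filter-↭; ∈-resp-↭; map⁺; All-resp-↭; ++⁺; ++⁺ʳ)
import Data.List.Relation.Binary.Permutation.Setoid.Properties as ↭ₛ
open import Data.Empty using (⊥)
open import Data.Product using (∃; _×_; _,_; proj₁; proj₂)
open import Data.Sum using (_⊎_; inj₁; inj₂)
open import Function using (_∘_; id)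
open import Function.Bundles using (_⇔_; mk⇔; Equivalence)
import Function.Properties.Equivalence as ⇔
open import Relation.Nullary using (¬_; yes; no; contradiction)
open import Relation.Nullary.Decidable using (decidable-stable; ¬?; _×-dec_)
open import Relation.Unary using (Pred; Decidable)
open import Relation.Binary.Definitions using (DecidableEquality)
open import Relation.Binary.PropositionalEquality using (_≡_; _≢_; refl; sym; trans; cong; cong₂; subst; subst₂; setoid; module ≡-Reasoning)

-- Let n = 2k+1 and C = [n] ∖ −N, split as C = P ++ R with P the k − |N| smallest elements.
-- The zigzag word v₀ q₁ v₁ ⋯ q_k v_k whose peaks are N in increasing order followed by P, and
-- whose valleys are −R in increasing order, has pinnacle set N ⊔ P as soon as every peak exceeds
-- its two valleys. Positive peaks do, and the peaks in N do provided
-- #{x ∈ N : x ≤ q} < #{v ∈ −R : v < q} for every q ∈ N.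
-- This count is read off a word w realising N: in w every x ∈ N with x ≤ q has both neighbours
-- below q and outside N, and in any word whose marked entries all have both neighbours in a
-- second class, that class outnumbers the marked entries. Those neighbours are negative and
-- outside N, hence negatives of elements of C. At q = 0 the count gives |N| ≤ k, so |R| = k + 1;
-- and passing from C to R is harmless, since if −p < q for some p ∈ P then all of −R lies below q.

-- Counting

module _ {a p} {A : Set a} {P : Pred A p} (P? : Decidable P) where

  count : List A → ℕ
  count = length ∘ filter P?

  count-accept : ∀ {x} l → P x → count (x ∷ l) ≡ suc (count l)
  count-accept l px = cong length (filter-accept P? px)

  count-reject : ∀ {x} l → ¬ P x → count (x ∷ l) ≡ count l
  count-reject l ¬px = cong length (filter-reject P? ¬px)

  count-≤-∷ : ∀ x l → count l ≤ℕ count (x ∷ l)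
  count-≤-∷ x l with P? x
  ... | yes _ = ℕ.n≤1+n _
  ... | no _ = ℕ.≤-refl

  count-∷-≤ : ∀ x l → count (x ∷ l) ≤ℕ suc (count l)
  count-∷-≤ x l with P? x
  ... | yes _ = ℕ.≤-refl
  ... | no _ = ℕ.n≤1+n _

  count-pos : ∀ {x l} → x ∈ l → P x → 0 <ℕ count l
  count-pos x∈l px = ∈-length (∈-filter⁺ P? x∈l px)

  count-none : ∀ {l} → All (¬_ ∘ P) l → count l ≡ 0
  count-none none = cong length (filter-none P? none)

  count-↭ : ∀ {xs ys} → xs ↭ ys → count xs ≡ count ys
  count-↭ xs↭ys = ↭-length (filter-↭ P? xs↭ys)

  count-++ : ∀ xs ys → count (xs ++ ys) ≡ count xs + count ys
  count-++ xs ys = trans (cong length (filter-++ P? xs ys)) (length-++ (filter P? xs))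

count-map : ∀ {a b p} {A : Set a} {B : Set b} {P : Pred B p} (P? : Decidable P) (f : A → B) xs →
            count P? (map f xs) ≡ count (P? ∘ f) xs
count-map P? f [] = refl
count-map P? f (x ∷ xs) with P? (f x)
... | yes _ = cong suc (count-map P? f xs)
... | no _ = count-map P? f xs

unique-⊆⇒length≤ : ∀ {a} {A : Set a} (_≟_ : DecidableEquality A) {xs ys : List A} →
                    Unique xs → (∀ {x} → x ∈ xs → x ∈ ys) → length xs ≤ℕ length ys
unique-⊆⇒length≤ _≟_ {[]} _ _ = z≤n
unique-⊆⇒length≤ _≟_ {x ∷ xs} {ys} (x∉xs ∷ uxs) xs⊆ys =
  ℕ.≤-trans (s≤s (unique-⊆⇒length≤ _≟_ uxs xs⊆ys-x)) (filter-notAll ≢x? ys (¬¬x (xs⊆ys (here refl))))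
  where
  ≢x? : Decidable (_≢ x)
  ≢x? y = ¬? (y ≟ x)
  xs⊆ys-x : ∀ {y} → y ∈ xs → y ∈ filter ≢x? ys
  xs⊆ys-x y∈xs = ∈-filter⁺ ≢x? (xs⊆ys (there y∈xs)) (λ y≡x → All.lookup x∉xs y∈xs (sym y≡x))
  ¬¬x : ∀ {zs} → x ∈ zs → Any (λ y → ¬ ¬ y ≡ x) zs
  ¬¬x = Any.map (λ x≡y y≢x → y≢x (sym x≡y))

AllPairs-++-∈ : ∀ {a r} {A : Set a} {R : A → A → Set r} xs {ys x y} → AllPairs R (xs ++ ys) → x ∈ xs → y ∈ ys → R x y
AllPairs-++-∈ (_ ∷ xs) (x<ys ∷ _) (here refl) y∈ys = All.lookup x<ys (∈-++⁺ʳ xs y∈ys)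
AllPairs-++-∈ (_ ∷ xs) (_ ∷ xs++ys↑) (there x∈xs) y∈ys = AllPairs-++-∈ xs xs++ys↑ x∈xs y∈ys

++-filter-∉-↭ : ∀ {xs ys : List ℤ} → Unique xs → Unique ys → (∀ {x} → x ∈ xs → x ∈ ys) →
                xs ++ filter (λ y → ¬? (y ∈? xs)) ys ↭ ys
++-filter-∉-↭ {xs} {ys} uxs uys xs⊆ys =
  ∼bag⇒↭ (unique∧set⇒bag (UP.++⁺ uxs (UP.filter⁺ ∉xs? uys) disjoint) uys (mk⇔ to from))
  where
  ∉xs? : Decidable (_∉ xs)
  ∉xs? y = ¬? (y ∈? xs)
  disjoint : ∀ {z} → ¬ (z ∈ xs × z ∈ filter ∉xs? ys)
  disjoint (z∈xs , z∈rest) = proj₂ (∈-filter⁻ ∉xs? {xs = ys} z∈rest) z∈xs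
  to : ∀ {z} → z ∈ xs ++ filter ∉xs? ys → z ∈ ys
  to z∈ with ∈-++⁻ xs z∈
  ... | inj₁ z∈xs = xs⊆ys z∈xs
  ... | inj₂ z∈rest = proj₁ (∈-filter⁻ ∉xs? {xs = ys} z∈rest)
  from : ∀ {z} → z ∈ ys → z ∈ xs ++ filter ∉xs? ys
  from {z} z∈ys with z ∈? xs
  ... | yes z∈xs = ∈-++⁺ˡ z∈xs
  ... | no z∉xs = ∈-++⁺ʳ xs (∈-filter⁺ ∉xs? z∈ys z∉xs)

module Flanking {a ℓ} {A : Set a} {P Q : Pred A ℓ}
                (P? : Decidable P) (Q? : Decidable Q) where

  -- Flanked x l: in the word x ∷ l every P-entry is followed by a Q-entry, and every
  -- P-entry other than x is preceded by one.
  Flanked : A → List A → Set ℓ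
  Flanked x [] = ¬ P x
  Flanked x (y ∷ l) = (P x → Q y) × (P y → Q x) × Flanked y l

  count≤count-tail : ∀ x l → Flanked x l → count P? (x ∷ l) ≤ℕ count Q? l
  count≤count-tail x [] ¬px = ℕ.≤-reflexive (count-reject P? [] ¬px)
  count≤count-tail x (y ∷ l) (x⇒y , _ , fl) with P? x
  ... | no _ = ℕ.≤-trans (count≤count-tail y l fl) (count-≤-∷ Q? y l)
  ... | yes px with Q? y
  ...   | yes _ = s≤s (count≤count-tail y l fl)
  ...   | no ¬qy = contradiction (x⇒y px) ¬qy

  count<count : ∀ x l → ¬ P x → Flanked x l → 0 <ℕ count P? (x ∷ l) → count P? (x ∷ l) <ℕ count Q? (x ∷ l)
  count<count x [] ¬px _ pos = contradiction (subst (0 <ℕ_) (count-reject P? [] ¬px) pos) λ ()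
  count<count x (y ∷ l) ¬px (_ , y⇒x , fl) pos with P? x | P? y
  ... | yes px | _ = contradiction px ¬px
  ... | no _ | no ¬py = ℕ.≤-trans (count<count y l ¬py fl pos) (count-≤-∷ Q? x (y ∷ l))
  ... | no _ | yes py with Q? x
  ...   | yes _ = s≤s (ℕ.≤-trans (count≤count-tail y l fl) (count-≤-∷ Q? y l))
  ...   | no ¬qx = contradiction (y⇒x py) ¬qx

-- Pinnacles

LastBelow : ℤ → List ℤ → Set
LastBelow x [] = ⊥
LastBelow x (z ∷ []) = z < x
LastBelow x (_ ∷ z ∷ l) = LastBelow x (z ∷ l)

HeadBelow : ℤ → List ℤ → Set
HeadBelow x [] = ⊥
HeadBelow x (z ∷ _) = z < x

LastBelow-∷ʳ⁻ : ∀ pre {x y} → LastBelow y (pre ∷ʳ x) → x < y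
LastBelow-∷ʳ⁻ [] x<y = x<y
LastBelow-∷ʳ⁻ (_ ∷ []) x<y = x<y
LastBelow-∷ʳ⁻ (_ ∷ z ∷ pre) h = LastBelow-∷ʳ⁻ (z ∷ pre) h

pinnacle-∈ : ∀ {l x} → IsPinnacle l x → x ∈ l
pinnacle-∈ (here _ _) = there (here refl)
pinnacle-∈ (there p) = there (pinnacle-∈ p)

pinnacle-∈-tail : ∀ {a l x} → IsPinnacle (a ∷ l) x → x ∈ l
pinnacle-∈-tail (here _ _) = here refl
pinnacle-∈-tail (there p) = pinnacle-∈ p

pinnacle-∷⁻ : ∀ {a l x} → IsPinnacle (a ∷ l) x → (∃ λ l′ → l ≡ x ∷ l′) ⊎ IsPinnacle l x
pinnacle-∷⁻ (here _ _) = inj₁ (_ , refl)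
pinnacle-∷⁻ (there p) = inj₂ p

pinnacle-neighbours : ∀ pre {x s} → Unique (pre ++ x ∷ s) → IsPinnacle (pre ++ x ∷ s) x →
                      LastBelow x pre × HeadBelow x s
pinnacle-neighbours [] u p = contradiction (pinnacle-∈-tail p) (Unique[x∷xs]⇒x∉xs u)
pinnacle-neighbours (_ ∷ []) u (here a<x c<x) = a<x , c<x
pinnacle-neighbours (_ ∷ []) (_ ∷ u) (there p) = contradiction (pinnacle-∈-tail p) (Unique[x∷xs]⇒x∉xs u)
pinnacle-neighbours (_ ∷ b ∷ pre) (_ ∷ u) p with pinnacle-∷⁻ p
... | inj₁ (_ , refl) = contradiction (∈-++⁺ʳ pre (here refl)) (Unique[x∷xs]⇒x∉xs u)
... | inj₂ p′ = pinnacle-neighbours (b ∷ pre) u p′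

module _ (N : List ℤ) (q : ℤ) where

  pinnacleAtMost? : Decidable (λ x → x ∈ N × x ≤ q)
  pinnacleAtMost? x = (x ∈? N) ×-dec (x ≤? q)

  otherBelow? : Decidable (λ x → x ∉ N × x < q)
  otherBelow? x = ¬? (x ∈? N) ×-dec (x <? q)

  module _ {w : List ℤ} (uw : Unique w) (N⊆pin : ∀ {x} → x ∈ N → IsPinnacle w x) where

    open Flanking pinnacleAtMost? otherBelow?

    private
      neighbours : ∀ pre {x s} → pre ++ x ∷ s ≡ w → x ∈ N → LastBelow x pre × HeadBelow x s
      neighbours pre {x} refl xN = pinnacle-neighbours pre uw (N⊆pin xN)

      flanked : ∀ pre x s → pre ++ x ∷ s ≡ w → Flanked x s
      flanked pre x [] eq (xN , _) = proj₂ (neighbours pre eq xN)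
      flanked pre x (y ∷ s) eq = x⇒y , y⇒x , flanked (pre ∷ʳ x) y s eq′
        where
        eq′ : (pre ∷ʳ x) ++ y ∷ s ≡ w
        eq′ = trans (++-assoc pre (x ∷ []) (y ∷ s)) eq
        y<x : x ∈ N → y < x
        y<x xN = proj₂ (neighbours pre eq xN)
        x<y : y ∈ N → x < y
        x<y yN = LastBelow-∷ʳ⁻ pre (proj₁ (neighbours (pre ∷ʳ x) eq′ yN))
        x⇒y : x ∈ N × x ≤ q → y ∉ N × y < q
        x⇒y (xN , x≤q) = (λ yN → <-asym (y<x xN) (x<y yN)) , <-≤-trans (y<x xN) x≤q
        y⇒x : y ∈ N × y ≤ q → x ∉ N × x < q
        y⇒x (yN , y≤q) = (λ xN → <-asym (x<y yN) (y<x xN)) , <-≤-trans (x<y yN) y≤q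

    pinnacles-outnumbered : 0 <ℕ count pinnacleAtMost? w → count pinnacleAtMost? w <ℕ count otherBelow? w
    pinnacles-outnumbered = outnumbered w refl
      where
      outnumbered : ∀ l → l ≡ w → 0 <ℕ count pinnacleAtMost? l → count pinnacleAtMost? l <ℕ count otherBelow? l
      outnumbered [] _ ()
      outnumbered (x ∷ s) eq = count<count x s (λ (xN , _) → proj₁ (neighbours [] eq xN)) (flanked [] x s eq)

-- Zigzag words

mutual
  interleave : ℤ → List ℤ → List ℤ → List ℤ
  interleave v ps vs = v ∷ interleave′ ps vs

  interleave′ : List ℤ → List ℤ → List ℤ
  interleave′ (p ∷ ps) (v ∷ vs) = p ∷ interleave v ps vs
  interleave′ _ _ = []

data Zigzag : ℤ → List ℤ → List ℤ → Set where
  []  : ∀ {v} → Zigzag v [] []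
  _∷_ : ∀ {v p v′ ps vs} → v < p × v′ < p → Zigzag v′ ps vs → Zigzag v (p ∷ ps) (v′ ∷ vs)

pinnacle-interleave⁻ : ∀ {v ps vs x} → Zigzag v ps vs → IsPinnacle (interleave v ps vs) x → x ∈ ps
pinnacle-interleave⁻ [] (there ())
pinnacle-interleave⁻ (_ ∷ _) (here _ _) = here refl
pinnacle-interleave⁻ ((_ , v′<p) ∷ (_ ∷ _)) (there (here p<v′ _)) = contradiction v′<p (<-asym p<v′)
pinnacle-interleave⁻ (_ ∷ z) (there (there p)) = there (pinnacle-interleave⁻ z p)

pinnacle-interleave⁺ : ∀ {v ps vs x} → Zigzag v ps vs → x ∈ ps → IsPinnacle (interleave v ps vs) x
pinnacle-interleave⁺ ((v<p , v′<p) ∷ _) (here refl) = here v<p v′<p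
pinnacle-interleave⁺ (_ ∷ z) (there x∈ps) = there (there (pinnacle-interleave⁺ z x∈ps))

interleave-↭ : ∀ {v ps vs} → Zigzag v ps vs → interleave v ps vs ↭ v ∷ ps ++ vs
interleave-↭ [] = ↭-refl
interleave-↭ {v} {p ∷ ps} {v′ ∷ vs} (_ ∷ z) =
  prep v (prep p (↭-trans (interleave-↭ z) (↭-sym (shift v′ ps vs))))

head<-of-sorted : ∀ {q x xs} → AllPairs _≤_ (x ∷ xs) → 0 <ℕ count (_<? q) (x ∷ xs) → x < q
head<-of-sorted {q} {x} (x≤xs ∷ _) pos = decidable-stable (x <? q) λ x≮q →
  ℕ.<-irrefl (sym (count-none (_<? q) (x≮q ∷ All.map (λ x≤y y<q → x≮q (≤-<-trans x≤y y<q)) x≤xs))) pos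

zigzag-of-signs : ∀ {v ps vs} → All (0ℤ <_) ps → All (_< 0ℤ) (v ∷ vs) → length ps ≡ length vs → Zigzag v ps vs
zigzag-of-signs {ps = []} {[]} _ _ _ = []
zigzag-of-signs {ps = p ∷ ps} {v′ ∷ vs} (0<p ∷ pos) (v<0 ∷ v′<0 ∷ neg) eq =
  (<-trans v<0 0<p , <-trans v′<0 0<p) ∷ zigzag-of-signs pos (v′<0 ∷ neg) (ℕ.suc-injective eq)

zigzag-of-sorted : ∀ ns {v vs ps} → AllPairs _≤_ ns → AllPairs _≤_ (v ∷ vs) →
                   All (λ q → count (_≤? q) ns <ℕ count (_<? q) (v ∷ vs)) ns →
                   All (0ℤ <_) ps → All (_< 0ℤ) (v ∷ vs) → length ns + length ps ≡ length vs →
                   Zigzag v (ns ++ ps) vs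
zigzag-of-sorted [] _ _ _ pos neg eq = zigzag-of-signs pos neg eq
zigzag-of-sorted (q ∷ ns) {v} {v′ ∷ vs} (q≤ns ∷ ns↑) (v≤vs ∷ vs↑) (few ∷ fews) pos (_ ∷ neg) eq =
  (v<q , v′<q) ∷ zigzag-of-sorted ns ns↑ vs↑ (All.zipWith drop-q (q≤ns , fews)) pos neg (ℕ.suc-injective eq)
  where
  v′<q : v′ < q
  v′<q = head<-of-sorted vs↑ (s≤s⁻¹ (begin
    2                                ≤⟨ s≤s (s≤s z≤n) ⟩
    suc (suc (count (_≤? q) ns))     ≡⟨ cong suc (count-accept (_≤? q) ns ≤-refl) ⟨
    suc (count (_≤? q) (q ∷ ns))     ≤⟨ few ⟩
    count (_<? q) (v ∷ v′ ∷ vs)      ≤⟨ count-∷-≤ (_<? q) v (v′ ∷ vs) ⟩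
    suc (count (_<? q) (v′ ∷ vs))    ∎))
    where open ℕ.≤-Reasoning
  v<q : v < q
  v<q = ≤-<-trans (All.head v≤vs) v′<q
  drop-q : ∀ {q′} → q ≤ q′ × count (_≤? q′) (q ∷ ns) <ℕ count (_<? q′) (v ∷ v′ ∷ vs) →
           count (_≤? q′) ns <ℕ count (_<? q′) (v′ ∷ vs)
  drop-q {q′} (q≤q′ , few′) =
    s<s⁻¹ (subst₂ _<ℕ_ (count-accept (_≤? q′) ns q≤q′) (count-accept (_<? q′) (v′ ∷ vs) (<-≤-trans v<q q≤q′)) few′)

-- Signed permutations

range-unique : ∀ n → Unique (range n)
range-unique n = UP.map⁺ ℕ.suc-injective (UP.upTo⁺ n)

length-range : ∀ n → length (range n) ≡ n
length-range n = trans (length-map suc (upTo n)) (length-upTo n)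

IsSignedPerm-unique : ∀ {n w} → IsSignedPerm n w → Unique w
IsSignedPerm-unique w↭ = UP.map⁻ (↭ₛ.Unique-resp-↭ (setoid ℕ) (↭⇒↭ₛ (↭-sym w↭)) (range-unique _))

IsSignedPerm-∣∣∈range : ∀ {n w x} → IsSignedPerm n w → x ∈ w → ∣ x ∣ ∈ range n
IsSignedPerm-∣∣∈range w↭ x∈w = ∈-resp-↭ w↭ (∈-map⁺ ∣_∣ x∈w)

InAPSB-resp-↭ : ∀ {n S S′} → S ↭ S′ → InAPSB n S → InAPSB n S′
InAPSB-resp-↭ S↭S′ (w , w↭ , pin) = w , w↭ , λ x → ⇔.trans (↭-∈-⇔ (↭-sym S↭S′)) (pin x)
  where ↭-∈-⇔ : ∀ {x xs ys} → xs ↭ ys → (x ∈ xs) ⇔ (x ∈ ys)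
        ↭-∈-⇔ xs↭ys = mk⇔ (∈-resp-↭ xs↭ys) (∈-resp-↭ (↭-sym xs↭ys))

zigzag-∈APSB : ∀ {n v ps vs} → Zigzag v ps vs → map ∣_∣ (v ∷ ps ++ vs) ↭ range n → InAPSB n ps
zigzag-∈APSB {v = v} {ps} {vs} z abs↭ =
  interleave v ps vs , ↭-trans (map⁺ ∣_∣ (interleave-↭ z)) abs↭ ,
  λ x → mk⇔ (pinnacle-interleave⁺ z) (pinnacle-interleave⁻ z)

sorted-∈APSB : ∀ {n} ns ps us → AllPairs _≤_ ns → AllPairs _≤_ us →
               All (λ q → count (_≤? q) ns <ℕ count (_<? q) us) ns →
               All (0ℤ <_) ps → All (_< 0ℤ) us → suc (length ns + length ps) ≡ length us →
               map ∣_∣ ((ns ++ ps) ++ us) ↭ range n → InAPSB n (ns ++ ps)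
sorted-∈APSB ns ps [] _ _ _ _ _ () _
sorted-∈APSB ns ps (v ∷ vs) ns↑ us↑ few pos neg eq abs↭ =
  zigzag-∈APSB (zigzag-of-sorted ns ns↑ us↑ few pos neg (ℕ.suc-injective eq))
               (↭-trans (map⁺ ∣_∣ (↭-sym (shift v (ns ++ ps) vs))) abs↭)

-- Realising N ⊔ P

-∣∣≡ : ∀ {x} → x < 0ℤ → - x ≡ + ∣ x ∣
-∣∣≡ { -[1+ _ ]} _ = refl
-∣∣≡ {+ _} (+<+ ())

map-∣∣-neg : ∀ xs → map ∣_∣ (map -_ xs) ≡ map ∣_∣ xs
map-∣∣-neg xs = trans (sym (map-∘ xs)) (map-cong ∣-i∣≡∣i∣ xs)

2k+1≡k+[1+k] : ∀ k → 2 * k + 1 ≡ k + suc k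
2k+1≡k+[1+k] = solve-∀

smaller-part≤k : ∀ {a} {A : Set a} k (xs : List A) {c} → (∀ {x} → x ∈ xs → length xs <ℕ c) →
                 length xs + c ≡ 2 * k + 1 → length xs ≤ℕ k
smaller-part≤k k [] _ _ = z≤n
smaller-part≤k k (x ∷ xs) {c} short eq = ℕ.≮⇒≥ λ k<m → ℕ.<-irrefl (sym eq) (begin-strict
  2 * k + 1              ≡⟨ 2k+1≡k+[1+k] k ⟩
  k + suc k              <⟨ ℕ.+-monoˡ-< (suc k) (ℕ.n<1+n k) ⟩
  suc k + suc k          ≤⟨ ℕ.+-mono-≤ k<m (ℕ.<-trans k<m (short (here refl))) ⟩
  length (x ∷ xs) + c    ∎)
  where open ℕ.≤-Reasoning

larger-part≡ : ∀ {m c} k → m ≤ℕ k → m + c ≡ 2 * k + 1 → c ≡ (k ∸ m) + suc k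
larger-part≡ {m} {c} k m≤k eq = ℕ.+-cancelˡ-≡ m c _ (begin
  m + c                  ≡⟨ eq ⟩
  2 * k + 1              ≡⟨ 2k+1≡k+[1+k] k ⟩
  k + suc k              ≡⟨ cong (_+ suc k) (ℕ.m+[n∸m]≡n m≤k) ⟨
  m + (k ∸ m) + suc k    ≡⟨ ℕ.+-assoc m (k ∸ m) (suc k) ⟩
  m + ((k ∸ m) + suc k)  ∎)
  where open ≡-Reasoning

module Realisation (k : ℕ) (N : List ℤ) (uN : Unique N) (N<0 : All (_< 0ℤ) N) {w : List ℤ}
                   (w↭ : IsSignedPerm (2 * k + 1) w) (pin : IsPinnacleSetOf w N) where

  n j : ℕ
  n = 2 * k + 1
  j = k ∸ length N

  C P R : List ℤ
  C = complementNeg n N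
  P = take j C
  R = drop j C

  N⊆pin : ∀ {x} → x ∈ N → IsPinnacle w x
  N⊆pin {x} = Equivalence.to (pin x)

  -x∈ℤrange : ∀ {x} → x ∈ w → x < 0ℤ → - x ∈ map +_ (range n)
  -x∈ℤrange x∈w x<0 = subst (_∈ _) (sym (-∣∣≡ x<0)) (∈-map⁺ +_ (IsSignedPerm-∣∣∈range w↭ x∈w))

  -N++C↭ : map -_ N ++ C ↭ map +_ (range n)
  -N++C↭ = ++-filter-∉-↭ (UP.map⁺ neg-injective uN) (UP.map⁺ +-injective (range-unique n)) -N⊆
    where
    -N⊆ : ∀ {y} → y ∈ map -_ N → y ∈ map +_ (range n)
    -N⊆ y∈-N with ∈-map⁻ -_ y∈-N
    ... | x , x∈N , refl = -x∈ℤrange (pinnacle-∈ (N⊆pin x∈N)) (All.lookup N<0 x∈N)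

  -x∈C : ∀ {x} → x ∈ w → x < 0ℤ → x ∉ N → - x ∈ C
  -x∈C x∈w x<0 x∉N = ∈-filter⁺ _ (-x∈ℤrange x∈w x<0) λ -x∈-N →
    let (y , y∈N , -x≡-y) = ∈-map⁻ -_ -x∈-N in x∉N (subst (_∈ N) (sym (neg-injective -x≡-y)) y∈N)

  C-positive : All (0ℤ <_) C
  C-positive = AllP.filter⁺ _ (AllP.map⁺ (AllP.map⁺ (All.universal (λ _ → +<+ (s≤s z≤n)) (upTo n))))

  C-ascending : AllPairs _<_ C
  C-ascending = APP.filter⁺ _ (APP.map⁺ (APP.map⁺ (APP.applyUpTo⁺₁ id n (λ i<j _ → +<+ (s<s i<j)))))

  |N|+|C| : length N + length C ≡ n
  |N|+|C| = begin
    length N + length C           ≡⟨ cong (_+ length C) (length-map -_ N) ⟨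
    length (map -_ N) + length C  ≡⟨ length-++ (map -_ N) ⟨
    length (map -_ N ++ C)        ≡⟨ ↭-length -N++C↭ ⟩
    length (map +_ (range n))     ≡⟨ length-map +_ (range n) ⟩
    length (range n)              ≡⟨ length-range n ⟩
    n                             ∎
    where open ≡-Reasoning

  fewer-than-in-C : ∀ {q x} → q ≤ 0ℤ → x ∈ N → x ≤ q → count (_≤? q) N <ℕ count (λ c → - c <? q) C
  fewer-than-in-C {q} {x} q≤0 x∈N x≤q = begin-strict
    count (_≤? q) N                                ≤⟨ unique-⊆⇒length≤ _≟_ (UP.filter⁺ _ uN) N≤q⊆ ⟩
    count (pinnacleAtMost? N q) w                  <⟨ pinnacles-outnumbered N q uw N⊆pin pos ⟩
    count (otherBelow? N q) w                      ≡⟨ length-map -_ (filter (otherBelow? N q) w) ⟨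
    length (map -_ (filter (otherBelow? N q) w))   ≤⟨ unique-⊆⇒length≤ _≟_ (UP.map⁺ neg-injective (UP.filter⁺ _ uw)) ⊆C ⟩
    count (λ c → - c <? q) C                       ∎
    where
    open ℕ.≤-Reasoning
    uw : Unique w
    uw = IsSignedPerm-unique w↭
    pos : 0 <ℕ count (pinnacleAtMost? N q) w
    pos = count-pos (pinnacleAtMost? N q) (pinnacle-∈ (N⊆pin x∈N)) (x∈N , x≤q)
    N≤q⊆ : ∀ {y} → y ∈ filter (_≤? q) N → y ∈ filter (pinnacleAtMost? N q) w
    N≤q⊆ y∈ = let (y∈N , y≤q) = ∈-filter⁻ (_≤? q) y∈ in
      ∈-filter⁺ (pinnacleAtMost? N q) (pinnacle-∈ (N⊆pin y∈N)) (y∈N , y≤q)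
    ⊆C : ∀ {y} → y ∈ map -_ (filter (otherBelow? N q) w) → y ∈ filter (λ c → - c <? q) C
    ⊆C y∈ with ∈-map⁻ -_ y∈
    ... | x , x∈ , refl with ∈-filter⁻ (otherBelow? N q) x∈
    ...   | x∈w , x∉N , x<q = ∈-filter⁺ (λ c → - c <? q) (-x∈C x∈w (<-≤-trans x<q q≤0) x∉N)
                                (subst (_< q) (sym (neg-involutive x)) x<q)

  |N|≤k : length N ≤ℕ k
  |N|≤k = smaller-part≤k k N (λ {x} x∈N → begin-strict
    length N                   ≡⟨ cong length (filter-all (_≤? 0ℤ) (All.map <⇒≤ N<0)) ⟨
    count (_≤? 0ℤ) N           <⟨ fewer-than-in-C ≤-refl x∈N (<⇒≤ (All.lookup N<0 x∈N)) ⟩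
    count (λ c → - c <? 0ℤ) C  ≤⟨ length-filter _ C ⟩
    length C                   ∎) |N|+|C|
    where open ℕ.≤-Reasoning

  |C|≡ : length C ≡ j + suc k
  |C|≡ = larger-part≡ k |N|≤k |N|+|C|

  |R|≡ : length R ≡ suc k
  |R|≡ = trans (length-drop j C) (trans (cong (_∸ j) |C|≡) (ℕ.m+n∸m≡n j (suc k)))

  |P|≡ : length P ≡ j
  |P|≡ = trans (length-take j C) (ℕ.m≤n⇒m⊓n≡m (subst (j ≤ℕ_) (sym |C|≡) (ℕ.m≤m+n j (suc k))))

  fewer-than-in-R : ∀ {q} → q ∈ N → count (_≤? q) N <ℕ count (λ r → - r <? q) R
  fewer-than-in-R {q} q∈N with any? (λ p → - p <? q) P
  ... | yes ∃p = begin-strict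
    count (_≤? q) N           ≤⟨ length-filter (_≤? q) N ⟩
    length N                  ≤⟨ |N|≤k ⟩
    k                         <⟨ ℕ.n<1+n k ⟩
    suc k                     ≡⟨ |R|≡ ⟨
    length R                  ≡⟨ cong length (filter-all (λ r → - r <? q) all-R) ⟨
    count (λ r → - r <? q) R  ∎
    where
    open ℕ.≤-Reasoning
    P++R↑ : AllPairs _<_ (P ++ R)
    P++R↑ = subst (AllPairs _<_) (sym (take++drop≡id j C)) C-ascending
    all-R : All (λ r → - r < q) R
    all-R = let (p , p∈P , -p<q) = find ∃p in
      All.tabulate λ r∈R → <-trans (neg-mono-< (AllPairs-++-∈ P P++R↑ p∈P r∈R)) -p<q
  ... | no ∄p = begin-strict
    count (_≤? q) N                                       <⟨ fewer-than-in-C (<⇒≤ q<0) q∈N ≤-refl ⟩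
    count (λ c → - c <? q) C                              ≡⟨ cong (count (λ c → - c <? q)) (take++drop≡id j C) ⟨
    count (λ c → - c <? q) (P ++ R)                       ≡⟨ count-++ (λ c → - c <? q) P R ⟩
    count (λ c → - c <? q) P + count (λ c → - c <? q) R  ≡⟨ cong (_+ count (λ c → - c <? q) R) (count-none _ (AllP.¬Any⇒All¬ P ∄p)) ⟩
    count (λ r → - r <? q) R                              ∎
    where
    open ℕ.≤-Reasoning
    q<0 : q < 0ℤ
    q<0 = All.lookup N<0 q∈N

  valleys : List ℤ
  valleys = sort (map -_ R)

  fewer-below-valleys : All (λ q → count (_≤? q) (sort N) <ℕ count (_<? q) valleys) (sort N)
  fewer-below-valleys = All.tabulate λ {q} q∈ → subst₂ _<ℕ_
    (sym (count-↭ (_≤? q) (sort-↭ N)))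
    (sym (trans (count-↭ (_<? q) (sort-↭ (map -_ R))) (count-map (_<? q) -_ R)))
    (fewer-than-in-R (∈-resp-↭ (sort-↭ N) q∈))

  valleys-negative : All (_< 0ℤ) valleys
  valleys-negative = All-resp-↭ (↭-sym (sort-↭ (map -_ R)))
    (AllP.map⁺ (All.map neg-mono-< (AllP.drop⁺ j C-positive)))

  |peaks|<|valleys| : suc (length (sort N) + length P) ≡ length valleys
  |peaks|<|valleys| = begin
    suc (length (sort N) + length P)  ≡⟨ cong suc (cong₂ _+_ (↭-length (sort-↭ N)) |P|≡) ⟩
    suc (length N + j)                ≡⟨ cong suc (ℕ.m+[n∸m]≡n |N|≤k) ⟩
    suc k                             ≡⟨ |R|≡ ⟨
    length R                          ≡⟨ length-map -_ R ⟨
    length (map -_ R)                 ≡⟨ ↭-length (sort-↭ (map -_ R)) ⟨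
    length valleys                    ∎
    where open ≡-Reasoning

  ∣N++P++-R∣≡∣-N++C∣ : map ∣_∣ ((N ++ P) ++ map -_ R) ≡ map ∣_∣ (map -_ N ++ C)
  ∣N++P++-R∣≡∣-N++C∣ = begin
    map ∣_∣ ((N ++ P) ++ map -_ R)           ≡⟨ map-++ ∣_∣ (N ++ P) (map -_ R) ⟩
    map ∣_∣ (N ++ P) ++ map ∣_∣ (map -_ R)  ≡⟨ cong₂ _++_ (map-++ ∣_∣ N P) (map-∣∣-neg R) ⟩
    (map ∣_∣ N ++ map ∣_∣ P) ++ map ∣_∣ R   ≡⟨ ++-assoc (map ∣_∣ N) (map ∣_∣ P) (map ∣_∣ R) ⟩
    map ∣_∣ N ++ (map ∣_∣ P ++ map ∣_∣ R)   ≡⟨ cong₂ _++_ (map-∣∣-neg N) (map-++ ∣_∣ P R) ⟨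
    map ∣_∣ (map -_ N) ++ map ∣_∣ (P ++ R)  ≡⟨ cong (λ C′ → map ∣_∣ (map -_ N) ++ map ∣_∣ C′) (take++drop≡id j C) ⟩
    map ∣_∣ (map -_ N) ++ map ∣_∣ C         ≡⟨ map-++ ∣_∣ (map -_ N) C ⟨
    map ∣_∣ (map -_ N ++ C)                  ∎
    where open ≡-Reasoning

  ∣peaks++valleys∣↭range : map ∣_∣ ((sort N ++ P) ++ valleys) ↭ range n
  ∣peaks++valleys∣↭range = begin
    map ∣_∣ ((sort N ++ P) ++ valleys)  ↭⟨ map⁺ ∣_∣ (++⁺ (++⁺ʳ P (sort-↭ N)) (sort-↭ (map -_ R))) ⟩
    map ∣_∣ ((N ++ P) ++ map -_ R)      ≡⟨ ∣N++P++-R∣≡∣-N++C∣ ⟩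
    map ∣_∣ (map -_ N ++ C)             ↭⟨ map⁺ ∣_∣ -N++C↭ ⟩
    map ∣_∣ (map +_ (range n))          ≡⟨ map-∘ (range n) ⟨
    map id (range n)                    ≡⟨ map-id (range n) ⟩
    range n                             ∎
    where open PermutationReasoning

  N++P∈APSB : InAPSB n (N ++ P)
  N++P∈APSB = InAPSB-resp-↭ (++⁺ʳ P (sort-↭ N))
    (sorted-∈APSB (sort N) P valleys
      (Linked⇒AllPairs ≤-trans (sort-↗ N)) (Linked⇒AllPairs ≤-trans (sort-↗ (map -_ R)))
      fewer-below-valleys (AllP.take⁺ j C-positive) valleys-negative |peaks|<|valleys| ∣peaks++valleys∣↭range)

corollary4p6 : (k : ℕ) (N : List ℤ) → Unique N → All (_< 0ℤ) N →
    InAPSB (2 * k + 1) N → InAPSB (2 * k + 1) (N ++ smallestP k N)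
corollary4p6 k N uN N<0 (w , w↭ , pin) = Realisation.N++P∈APSB k N uN N<0 w↭ pin
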